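{- Let $n \geq 5$ and $m \geq 1$ be integers and let $2 \leq s_2 < \dots < s_m \leq \lfloor \frac{n-1}{2} \rfloor$ be integers; put $S = (1, s_2, \dots, s_m)$. Let $C_n(S)$ be the circulant graph on vertex set $\mathbb{Z}_n = \{0,\dots,n-1\}$ in which $i$ and $j$ are adjacent iff $i-j \equiv \pm 1$ or $i - j \equiv \pm s_k \pmod n$ for some $2 \leq k \leq m$, and let $d_c$ denote its graph distance. Let $G$ be the graph with vertex set $\{u_i, v_i : i \in \mathbb{Z}_n\}$ and edge set consisting of the outer edges $u_i u_{i+1}$, the inner edges $v_i v_{i \pm s_k}$ ($2 \leq k \leq m$), and the spokes $u_i v_i$, for all $i \in \mathbb{Z}_n$ (subscripts modulo $n$); let $d_p$ denote its graph distance. Then for all vertices $i, j$ of $C_n(S)$ and all $x_i \in \{u_i, v_i\}$, $y_j \in \{u_j, v_j\}$, $$d_c(i,j) \leq d_p(x_i, y_j) \leq d_c(i,j) + 2.$$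
   Context: The graph $G$ is called $GGPG(n, m; s_2, \dots, s_m)$ in the paper (a generalization of the generalized Petersen graph); contracting all its spokes $u_iv_i$ yields $C_n(S)$. -}

module Defs where

open import Data.Nat using (ℕ; zero; suc; _+_; _≤_; _<_; NonZero)
open import Data.Nat.DivMod using (_%_)
open import Data.Fin using (Fin; toℕ)
open import Data.Product using (Σ; _×_)
open import Data.Sum using (_⊎_)
open import Relation.Binary.PropositionalEquality using (_≡_)

data Walk {V : Set} (E : V → V → Set) : V → V → ℕ → Set where
  here : ∀ {a} → Walk E a a 0
  step : ∀ {a b c k} → E a b → Walk E b c k → Walk E a c (suc k)

IsDist : {V : Set} (E : V → V → Set) → V → V → ℕ → Set
IsDist E a b d = Walk E a b d × (∀ k → Walk E a b k → d ≤ k)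

PlusMod : (n : ℕ) {{_ : NonZero n}} → Fin n → ℕ → Fin n → Set
PlusMod n i t j = toℕ j ≡ (toℕ i + t) % n

DiffPM : (n : ℕ) {{_ : NonZero n}} → Fin n → Fin n → ℕ → Set
DiffPM n i j t = PlusMod n i t j ⊎ PlusMod n j t i

CAdj : (n : ℕ) {{_ : NonZero n}} (m : ℕ) (s : ℕ → ℕ) → Fin n → Fin n → Set
CAdj n m s i j =
  DiffPM n i j 1 ⊎ Σ ℕ (λ k → 2 ≤ k × k ≤ m × DiffPM n i j (s k))

data GV (n : ℕ) : Set where
  u : Fin n → GV n
  v : Fin n → GV n

data GAdj (n : ℕ) {{_ : NonZero n}} (m : ℕ) (s : ℕ → ℕ) : GV n → GV n → Set where
  outer : ∀ {i j} → DiffPM n i j 1 → GAdj n m s (u i) (u j)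
  inner : ∀ {i j} k → 2 ≤ k → k ≤ m → DiffPM n i j (s k) → GAdj n m s (v i) (v j)
  spokeUV : ∀ i → GAdj n m s (u i) (v i)
  spokeVU : ∀ i → GAdj n m s (v i) (u i)

-- Contracting the spokes maps every walk of G onto a walk of C_n(S) that is
-- no longer, which gives d_c ≤ d_p. Conversely, all jumps of C_n(S) are
-- translations of ℤ_n, so they commute, and a walk of C_n(S) can be
-- rearranged into all its ±1-steps followed by all its ±s_k-steps (or the
-- other way round) without changing its length. Run the first part on the
-- outer cycle, cross one spoke, run the rest on the inner graph, and add at
-- most one further spoke to start or end on the requested side.
module Submission where

open import Defs
open import Data.Nat using (ℕ; suc; _+_; _∸_; _≤_; _<_; NonZero; z≤n; s≤s)
open import Data.Nat.DivMod using (_/_; _%_; %-distribˡ-+; m%n%n≡m%n; m%n<n; [m+n]%n≡m%n; m<n⇒m%n≡m; m/n≤m)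
open import Data.Nat.Properties
open import Data.Fin using (Fin; toℕ; fromℕ<)
open import Data.Fin.Properties using (toℕ-fromℕ<; toℕ<n)
open import Data.Product using (_×_; Σ; ∃-syntax; _,_; proj₂)
open import Data.Sum as Sum using (_⊎_; inj₁; inj₂)
open import Relation.Binary.Core using (Rel; _⇒_)
open import Relation.Binary.Construct.Union using (_∪_)
open import Relation.Binary.PropositionalEquality
open import Level using (0ℓ)
open import Function using (id)

private
  variable
    V W : Set
    E F R Q R₁ R₂ Q₁ Q₂ : Rel V 0ℓ
    a b c : V
    k l d : ℕ

_++ʷ_ : Walk E a b k → Walk E b c l → Walk E a c (k + l)
here     ++ʷ w = w
step e r ++ʷ w = step e (r ++ʷ w)

Walk-map : (f : V → W) → (∀ {a b} → E a b → F (f a) (f b)) →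
           Walk E a b k → Walk F (f a) (f b) k
Walk-map f g here       = here
Walk-map f g (step e w) = step (g e) (Walk-map f g w)

Walk-contract : (f : V → W) → (∀ {a b} → E a b → F (f a) (f b) ⊎ f a ≡ f b) →
                Walk E a b k → ∃[ k′ ] k′ ≤ k × Walk F (f a) (f b) k′
Walk-contract f g here = 0 , z≤n , here
Walk-contract {F = F} f g (step {c = c} e w) with Walk-contract f g w | g e
... | k′ , k′≤k , w′ | inj₁ e′  = suc k′ , s≤s k′≤k , step e′ w′
... | k′ , k′≤k , w′ | inj₂ fa≡fb =
  k′ , m≤n⇒m≤1+n k′≤k , subst (λ x → Walk F x (f c) k′) (sym fa≡fb) w′

Commutes : Rel V 0ℓ → Rel V 0ℓ → Set
Commutes R Q = ∀ {a b c} → R a b → Q b c → ∃[ b′ ] Q a b′ × R b′ c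

∪-commutes : Commutes R₁ Q₁ → Commutes R₁ Q₂ → Commutes R₂ Q₁ → Commutes R₂ Q₂ →
             Commutes (R₁ ∪ R₂) (Q₁ ∪ Q₂)
∪-commutes c₁₁ _ _ _ (inj₁ r) (inj₁ q) with c₁₁ r q
... | b′ , q′ , r′ = b′ , inj₁ q′ , inj₁ r′
∪-commutes _ c₁₂ _ _ (inj₁ r) (inj₂ q) with c₁₂ r q
... | b′ , q′ , r′ = b′ , inj₂ q′ , inj₁ r′
∪-commutes _ _ c₂₁ _ (inj₂ r) (inj₁ q) with c₂₁ r q
... | b′ , q′ , r′ = b′ , inj₁ q′ , inj₂ r′
∪-commutes _ _ _ c₂₂ (inj₂ r) (inj₂ q) with c₂₂ r q
... | b′ , q′ , r′ = b′ , inj₂ q′ , inj₂ r′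

Commutes-resp : R ⇒ R₁ → Q ⇒ Q₁ → Q₁ ⇒ Q → R₁ ⇒ R → Commutes R₁ Q₁ → Commutes R Q
Commutes-resp R⇒R₁ Q⇒Q₁ Q₁⇒Q R₁⇒R comm r q with comm (R⇒R₁ r) (Q⇒Q₁ q)
... | b′ , q′ , r′ = b′ , Q₁⇒Q q′ , R₁⇒R r′

commute-past-walk : Commutes R Q → R a b → Walk Q b c k → ∃[ b′ ] Walk Q a b′ k × R b′ c
commute-past-walk comm r here = _ , here , r
commute-past-walk comm r (step q w) with comm r q
... | _ , q′ , r′ with commute-past-walk comm r′ w
... | b′ , w′ , r″ = b′ , step q′ w′ , r″

record SortedWalk (R Q : Rel V 0ℓ) (a c : V) (d : ℕ) : Set where
  field
    {middle} : V
    {length₁ length₂} : ℕ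
    lengths : length₁ + length₂ ≡ d
    first : Walk R a middle length₁
    second : Walk Q middle c length₂

sort-walk : Commutes Q R → Walk (R ∪ Q) a c d → SortedWalk R Q a c d
sort-walk comm here = record { lengths = refl ; first = here ; second = here }
sort-walk comm (step (inj₁ r) w) =
  let record { lengths = eq ; first = w₁ ; second = w₂ } = sort-walk comm w
  in record { lengths = cong suc eq ; first = step r w₁ ; second = w₂ }
sort-walk comm (step (inj₂ q) w) with sort-walk comm w
... | record { length₁ = k ; length₂ = l ; lengths = eq ; first = w₁ ; second = w₂ }
    with commute-past-walk comm q w₁
... | _ , w₁′ , q′ =
  record { lengths = trans (+-suc k l) (cong suc eq) ; first = w₁′ ; second = step q′ w₂ }

module Translations (n : ℕ) {{_ : NonZero n}} where
  open ≡-Reasoning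

  Plus : ℕ → Rel (Fin n) 0ℓ
  Plus t a b = PlusMod n a t b

  Diff : ℕ → Rel (Fin n) 0ℓ
  Diff t a b = DiffPM n a b t

  [m%n+k]%n≡[m+k]%n : ∀ x t → (x % n + t) % n ≡ (x + t) % n
  [m%n+k]%n≡[m+k]%n x t = begin
    (x % n + t) % n          ≡⟨ %-distribˡ-+ (x % n) t n ⟩
    (x % n % n + t % n) % n  ≡⟨ cong (λ z → (z + t % n) % n) (m%n%n≡m%n x n) ⟩
    (x % n + t % n) % n      ≡⟨ %-distribˡ-+ x t n ⟨
    (x + t) % n              ∎

  plus-twice : ∀ (a : Fin n) t t′ {b} → Plus t a b → (toℕ b + t′) % n ≡ (toℕ a + (t + t′)) % n
  plus-twice a t t′ {b} p = begin
    (toℕ b + t′) % n              ≡⟨ cong (λ z → (z + t′) % n) p ⟩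
    ((toℕ a + t) % n + t′) % n    ≡⟨ [m%n+k]%n≡[m+k]%n (toℕ a + t) t′ ⟩
    (toℕ a + t + t′) % n          ≡⟨ cong (_% n) (+-assoc (toℕ a) t t′) ⟩
    (toℕ a + (t + t′)) % n        ∎

  plus-commutes : ∀ t t′ → Commutes (Plus t) (Plus t′)
  plus-commutes t t′ {a} {b} {c} p q = b′ , b′-def , (begin
    toℕ c                    ≡⟨ q ⟩
    (toℕ b + t′) % n         ≡⟨ plus-twice a t t′ p ⟩
    (toℕ a + (t + t′)) % n   ≡⟨ cong (λ z → (toℕ a + z) % n) (+-comm t t′) ⟩
    (toℕ a + (t′ + t)) % n   ≡⟨ plus-twice a t′ t b′-def ⟨
    (toℕ b′ + t) % n         ∎)
    where
    b′ : Fin n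
    b′ = fromℕ< (m%n<n (toℕ a + t′) n)
    b′-def : Plus t′ a b′
    b′-def = toℕ-fromℕ< _

  plus-inverse : ∀ {t} {a b : Fin n} → t ≤ n → Plus t b a → Plus (n ∸ t) a b
  plus-inverse {t} {a} {b} t≤n p = sym (begin
    (toℕ a + (n ∸ t)) % n        ≡⟨ plus-twice b t (n ∸ t) p ⟩
    (toℕ b + (t + (n ∸ t))) % n  ≡⟨ cong (λ z → (toℕ b + z) % n) (m+[n∸m]≡n t≤n) ⟩
    (toℕ b + n) % n              ≡⟨ [m+n]%n≡m%n (toℕ b) n ⟩
    toℕ b % n                    ≡⟨ m<n⇒m%n≡m (toℕ<n b) ⟩
    toℕ b                        ∎)

  diff⇒plus± : ∀ {t} → t ≤ n → Diff t ⇒ (Plus t ∪ Plus (n ∸ t))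
  diff⇒plus± t≤n = Sum.map₂ (plus-inverse t≤n)

  plus±⇒diff : ∀ {t} → t ≤ n → (Plus t ∪ Plus (n ∸ t)) ⇒ Diff t
  plus±⇒diff {t} t≤n =
    Sum.map₂ (λ p → subst (λ z → Plus z _ _) (m∸[m∸n]≡n t≤n) (plus-inverse (m∸n≤m n t) p))

  diff-commutes : ∀ {t t′} → t ≤ n → t′ ≤ n → Commutes (Diff t) (Diff t′)
  diff-commutes {t} {t′} t≤n t′≤n =
    Commutes-resp {R₁ = Plus t ∪ Plus (n ∸ t)} {Q₁ = Plus t′ ∪ Plus (n ∸ t′)}
      (diff⇒plus± t≤n) (diff⇒plus± t′≤n) (plus±⇒diff t′≤n) (plus±⇒diff t≤n)
      (∪-commutes {R₁ = Plus t} {Q₁ = Plus t′} {Q₂ = Plus (n ∸ t′)} {R₂ = Plus (n ∸ t)}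
        (plus-commutes t t′) (plus-commutes t (n ∸ t′))
        (plus-commutes (n ∸ t) t′) (plus-commutes (n ∸ t) (n ∸ t′)))

module Spokes (n : ℕ) {{_ : NonZero n}} (m : ℕ) (s : ℕ → ℕ)
              (1≤n : 1 ≤ n) (s≤n : ∀ k → 2 ≤ k → k ≤ m → s k ≤ n) where
  open Translations n

  Outer : Rel (Fin n) 0ℓ
  Outer = Diff 1

  Inner : Rel (Fin n) 0ℓ
  Inner a b = Σ ℕ (λ k → 2 ≤ k × k ≤ m × Diff (s k) a b)

  C : Rel (Fin n) 0ℓ
  C = CAdj n m s

  G : Rel (GV n) 0ℓ
  G = GAdj n m s

  outer-commutes-inner : Commutes Outer Inner
  outer-commutes-inner e (k , 2≤k , k≤m , f) with diff-commutes 1≤n (s≤n k 2≤k k≤m) e f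
  ... | b′ , f′ , e′ = b′ , (k , 2≤k , k≤m , f′) , e′

  inner-commutes-outer : Commutes Inner Outer
  inner-commutes-outer (k , 2≤k , k≤m , f) e with diff-commutes (s≤n k 2≤k k≤m) 1≤n f e
  ... | b′ , e′ , f′ = b′ , e′ , (k , 2≤k , k≤m , f′)

  index : GV n → Fin n
  index (u i) = i
  index (v i) = i

  index-of : ∀ {i x} → x ≡ u i ⊎ x ≡ v i → index x ≡ i
  index-of (inj₁ refl) = refl
  index-of (inj₂ refl) = refl

  contract-spokes : ∀ {x y} → Walk G x y k → ∃[ k′ ] k′ ≤ k × Walk C (index x) (index y) k′
  contract-spokes = Walk-contract index contract-edge
    where
    contract-edge : ∀ {x y} → G x y → C (index x) (index y) ⊎ index x ≡ index y
    contract-edge (outer e)            = inj₁ (inj₁ e)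
    contract-edge (inner k 2≤k k≤m e)  = inj₁ (inj₂ (k , 2≤k , k≤m , e))
    contract-edge (spokeUV i)          = inj₂ refl
    contract-edge (spokeVU i)          = inj₂ refl

  lift-outer : ∀ {i j} → Walk Outer i j k → Walk G (u i) (u j) k
  lift-outer = Walk-map u outer

  lift-inner : ∀ {i j} → Walk Inner i j k → Walk G (v i) (v j) k
  lift-inner = Walk-map v (λ (k , 2≤k , k≤m , e) → inner k 2≤k k≤m e)

  outer-spoke-inner : ∀ {i j} → Walk C i j d → Walk G (u i) (v j) (suc d)
  outer-spoke-inner w with sort-walk inner-commutes-outer w
  ... | record { middle = b ; length₁ = k ; length₂ = l ; lengths = refl ; first = w₁ ; second = w₂ } =
    subst (Walk G _ _) (+-suc k l) (lift-outer w₁ ++ʷ step (spokeUV b) (lift-inner w₂))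

  inner-spoke-outer : ∀ {i j} → Walk C i j d → Walk G (v i) (u j) (suc d)
  inner-spoke-outer w with sort-walk outer-commutes-inner (Walk-map id Sum.swap w)
  ... | record { middle = b ; length₁ = k ; length₂ = l ; lengths = refl ; first = w₁ ; second = w₂ } =
    subst (Walk G _ _) (+-suc k l) (lift-inner w₁ ++ʷ step (spokeVU b) (lift-outer w₂))

  detour : ∀ {i j x y} → (x ≡ u i ⊎ x ≡ v i) → (y ≡ u j ⊎ y ≡ v j) →
           Walk C i j d → ∃[ k ] k ≤ 2 + d × Walk G x y k
  detour {i = i} (inj₁ refl) (inj₁ refl) w = _ , ≤-refl , step (spokeUV i) (inner-spoke-outer w)
  detour {i = i} (inj₂ refl) (inj₂ refl) w = _ , ≤-refl , step (spokeVU i) (outer-spoke-inner w)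
  detour (inj₁ refl) (inj₂ refl) w = _ , n≤1+n _ , outer-spoke-inner w
  detour (inj₂ refl) (inj₁ refl) w = _ , n≤1+n _ , inner-spoke-outer w

theorem4p1 : (n : ℕ) {{_ : NonZero n}} → 5 ≤ n →
    (m : ℕ) → 1 ≤ m → (s : ℕ → ℕ) →
    (∀ k → 2 ≤ k → k ≤ m → 2 ≤ s k × s k ≤ (n ∸ 1) / 2) →
    (∀ k → 2 ≤ k → suc k ≤ m → s k < s (suc k)) →
    (i j : Fin n) (x y : GV n) →
    (x ≡ u i ⊎ x ≡ v i) → (y ≡ u j ⊎ y ≡ v j) →
    (dc dp : ℕ) → IsDist (CAdj n m s) i j dc → IsDist (GAdj n m s) x y dp →
    dc ≤ dp × dp ≤ dc + 2
theorem4p1 n 5≤n m _ s s-bounds _ i j x y x-at-i y-at-j dc dp (wc , dc-min) (wp , dp-min) =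
  dc≤dp , dp≤dc+2
  where
  s≤n : ∀ k → 2 ≤ k → k ≤ m → s k ≤ n
  s≤n k 2≤k k≤m = ≤-trans (proj₂ (s-bounds k 2≤k k≤m)) (≤-trans (m/n≤m (n ∸ 1) 2) (m∸n≤m n 1))

  open Spokes n m s (≤-trans (s≤s z≤n) 5≤n) s≤n

  dc≤dp : dc ≤ dp
  dc≤dp with contract-spokes wp
  ... | k , k≤dp , w =
    ≤-trans (dc-min k (subst₂ (λ a b → Walk C a b k) (index-of x-at-i) (index-of y-at-j) w)) k≤dp

  dp≤dc+2 : dp ≤ dc + 2
  dp≤dc+2 with detour x-at-i y-at-j wc
  ... | k , k≤2+dc , w = ≤-trans (dp-min k w) (≤-trans k≤2+dc (≤-reflexive (+-comm 2 dc)))
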